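{- Let $\ell\ge 2$, let $p\in S_\ell$, let $k=\ell-2$, let $n$ be an integer and let $H\subseteq[n]$ be a $k$-element set. The following are equivalent: (1) $s_n^H(p)=1$; (2) the order graph $G_n^H(p)$ has no directed cycle; (3) $G_n^H(p)$ has no directed cycle of length $3$.
   Context: Write $H=\{h_1<\dots<h_k\}$, $I=[n]\setminus H$, $I_1=\{i\in I:i<h_1\}$, $I_{k+1}=\{i\in I:i>h_k\}$, $I_a=\{i\in I:h_{a-1}<i<h_a\}$ for $2\le a\le k$ (if $k=0$, $I_1=[n]$). The order graph $G_n^H(p)$ is the directed graph on vertex set $I$ where, for $i<j$ with $i\in I_a$ and $j\in I_b$, there is an edge from $i$ to $j$ if $p_a>p_{b+1}$ and an edge from $j$ to $i$ if $p_a<p_{b+1}$. A partial permutation with holes at $H$ is a sequence $\pi_1\cdots\pi_n$ with $\pi_i=\diamond$ (hole) iff $i\in H$ and the other entries being $1,\dots,n-k$ each once; a permutation $\sigma$ of $[n]$ is an extension of $\pi$ if the standardization (order-preserving relabeling by $1,2,\dots$) of $\sigma$ restricted to $I$ equals $\pi$ restricted to $I$; $\pi$ avoids $p$ if every extension avoids $p$ classically. $s_n^H(p)$ is the number of $p$-avoiding such partial permutations. -}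

module Defs where

open import Data.Nat as ℕ using (ℕ; zero; suc; _+_; _∸_; _≤_; _<?_)
open import Data.Nat.Properties using (_≤?_)
open import Data.Fin as Fin using (Fin; toℕ; fromℕ<)
open import Data.Fin.Permutation using (Permutation′; _⟨$⟩ʳ_)
open import Data.Fin.Subset using (Subset; _∈_; _∉_)
open import Data.Fin.Subset.Properties using (_∈?_)
open import Data.Bool using (Bool; true; false; _∧_; not)
open import Data.Maybe using (Maybe; just; nothing)
open import Data.Vec using (Vec; lookup)
open import Data.List using (List; []; _∷_; length)
open import Data.List.Relation.Unary.Unique.Propositional using (Unique)
open import Data.Product using (Σ; ∃; _×_; _,_)
open import Data.Sum using (_⊎_)
open import Relation.Nullary using (¬_; does; yes; no)
open import Relation.Binary.PropositionalEquality using (_≡_)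

-- Conventions: positions in [n] are 0-indexed (Fin n); pattern values
-- p ∈ S_ℓ are given as a permutation of Fin ℓ (values 0..ℓ-1).

countFin : ∀ {n} → (Fin n → Bool) → ℕ
countFin {zero}  f = 0
countFin {suc n} f = (if f Fin.zero then 1 else 0) + countFin (λ x → f (Fin.suc x))
  where open import Data.Bool using (if_then_else_)

-- value p(a) (0-indexed) for a natural index a; 0 if a is out of range
pAt : ∀ {ℓ} → Permutation′ ℓ → ℕ → ℕ
pAt {ℓ} p a with a <? ℓ
... | yes a<ℓ = toℕ (p ⟨$⟩ʳ fromℕ< a<ℓ)
... | no _    = 0

-- gap index (0-indexed): i ∈ I_{a} (1-indexed) iff gap H i = a - 1,
-- i.e. the number of holes h ∈ H with h < i
gap : ∀ {n} → Subset n → Fin n → ℕ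
gap H i = countFin (λ h → does (h ∈? H) ∧ does (h Fin.<? i))

-- For i < j (i ∈ I_a, j ∈ I_b): edge i → j iff p_a > p_{b+1}, edge j → i iff p_a < p_{b+1}.
-- In 0-indexed form p_a = pAt p (gap i), p_{b+1} = pAt p (suc (gap j)).
Edge : ∀ {ℓ n} → Permutation′ ℓ → Subset n → Fin n → Fin n → Set
Edge p H i j =
  i ∉ H × j ∉ H ×
  ( (i Fin.< j × pAt p (suc (gap H j)) ℕ.< pAt p (gap H i))
  ⊎ (j Fin.< i × pAt p (gap H j) ℕ.< pAt p (suc (gap H i))) )

PathTo : ∀ {ℓ n} → Permutation′ ℓ → Subset n → Fin n → List (Fin n) → Fin n → Set
PathTo p H v []       w = Edge p H v w
PathTo p H v (u ∷ us) w = Edge p H v u × PathTo p H u us w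

-- a directed cycle v₀ → v₁ → … → v_{m-1} → v₀ on distinct vertices,
-- given as the list of its vertices (its length is the cycle length)
DirectedCycle : ∀ {ℓ n} → Permutation′ ℓ → Subset n → List (Fin n) → Set
DirectedCycle p H []       = Data.Empty.⊥
  where import Data.Empty
DirectedCycle p H (v ∷ vs) = Unique (v ∷ vs) × PathTo p H v vs v

HasDirectedCycle : ∀ {ℓ n} → Permutation′ ℓ → Subset n → Set
HasDirectedCycle p H = ∃ λ cs → DirectedCycle p H cs

HasDirectedCycleOfLength : ∀ {ℓ n} → ℕ → Permutation′ ℓ → Subset n → Set
HasDirectedCycleOfLength m p H = ∃ λ cs → length cs ≡ m × DirectedCycle p H cs

-- π is a partial permutation of length n with holes exactly at H:
-- π_i = ◇ (nothing) iff i ∈ H, other entries are 1,…,n-k each exactly once (k = |H|)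
IsPartialPerm : ∀ {n} → (k : ℕ) → Subset n → Vec (Maybe ℕ) n → Set
IsPartialPerm {n} k H π =
  (∀ i → (i ∈ H → lookup π i ≡ nothing) × (lookup π i ≡ nothing → i ∈ H)) ×
  (∀ i v → lookup π i ≡ just v → 1 ≤ v × v ≤ n ∸ k) ×
  (∀ v → 1 ≤ v → v ≤ n ∸ k →
     Σ (Fin n) λ i → lookup π i ≡ just v × (∀ j → lookup π j ≡ just v → j ≡ i))

-- standardization of σ restricted to I = [n] ∖ H, evaluated at i ∈ I:
-- the rank of σ(i) among {σ(j) : j ∈ I}
stdRestr : ∀ {n} → Permutation′ n → Subset n → Fin n → ℕ
stdRestr σ H i = countFin (λ j → not (does (j ∈? H)) ∧ does (toℕ (σ ⟨$⟩ʳ j) ≤? toℕ (σ ⟨$⟩ʳ i)))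

IsExtension : ∀ {n} → Subset n → Permutation′ n → Vec (Maybe ℕ) n → Set
IsExtension H σ π = ∀ i → i ∉ H → lookup π i ≡ just (stdRestr σ H i)

Contains : ∀ {ℓ n} → Permutation′ n → Permutation′ ℓ → Set
Contains {ℓ} {n} σ p =
  Σ (Fin ℓ → Fin n) λ c →
    (∀ a b → a Fin.< b → c a Fin.< c b) ×
    (∀ a b → ((p ⟨$⟩ʳ a) Fin.< (p ⟨$⟩ʳ b) → (σ ⟨$⟩ʳ c a) Fin.< (σ ⟨$⟩ʳ c b)) ×
             ((σ ⟨$⟩ʳ c a) Fin.< (σ ⟨$⟩ʳ c b) → (p ⟨$⟩ʳ a) Fin.< (p ⟨$⟩ʳ b)))

AvoidsPartial : ∀ {ℓ n} → Subset n → Vec (Maybe ℕ) n → Permutation′ ℓ → Set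
AvoidsPartial {n = n} H π p = ∀ (σ : Permutation′ n) → IsExtension H σ π → ¬ Contains σ p

-- s_n^H(p) = 1: there is exactly one p-avoiding partial permutation with holes at H
SEqualsOne : ∀ {ℓ n} → (k : ℕ) → Subset n → Permutation′ ℓ → Set
SEqualsOne {n = n} k H p =
  Σ (Vec (Maybe ℕ) n) λ π → (IsPartialPerm k H π × AvoidsPartial H π p) ×
    (∀ π′ → IsPartialPerm k H π′ → AvoidsPartial H π′ p → π′ ≡ π)

-- The order graph is a tournament on the non-holes: for i < j it compares the letters of p at
-- g(i) and at g(j) + 1 (g the gap index), which differ since g(i) ≤ g(j). A tournament without
-- 3-cycles is transitive, hence acyclic. The heart of the matter is that a partial permutation
-- avoids p exactly when its values increase along every edge. If they do, an occurrence of p in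
-- an extension uses ℓ positions of which at most ℓ − 2 are holes, and a discrete intermediate
-- value argument on the gap indices finds two of them whose edge contradicts the occurrence. If
-- an edge u → v is inverted, the extension that puts every hole next to u or v according to its
-- letter contains p. So s = 1 means that exactly one numbering of the non-holes increases along
-- all edges: one exists iff the graph is acyclic (take ranks in the transitive tournament), and
-- it is unique because a tournament fixes the relative order of the values.

module Submission where

open import Defs
open import Level using (0ℓ)
open import Function using (_∘_; _on_; case_of_)
open import Function.Bundles using (_⇔_; mk⇔; Equivalence)
open import Data.Empty using (⊥)
open import Data.Fin as Fin using (Fin; toℕ; fromℕ<)
import Data.Fin.Properties as Finₚ
open import Data.Fin.Permutation using (Permutation′; _⟨$⟩ʳ_; _⟨$⟩ˡ_; inverseˡ; permutation)
open import Data.Fin.Subset using (Subset; _∈_; _∉_; ∣_∣; inside; outside)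
open import Data.Fin.Subset.Properties using (_∈?_)
open import Data.List using (_∷_; [])
open import Data.List.Relation.Unary.AllPairs using (_∷_; [])
open import Data.List.Relation.Unary.All using (_∷_; [])
open import Data.List.Relation.Unary.Unique.Propositional using (Unique)
open import Data.Maybe using (Maybe; just; nothing; fromMaybe)
open import Data.Nat using (ℕ; zero; suc; _+_; _*_; _∸_; _≤_; _<_; z≤n; s≤s; _<?_; _≟_)
open import Data.Nat.Properties
open import Data.Product using (Σ; ∃; ∃₂; _×_; _,_; proj₁; proj₂)
open import Data.Sum as Sum using (_⊎_; inj₁; inj₂)
open import Data.Unit using (tt)
open import Data.Vec using (Vec; []; _∷_; lookup; tabulate)
open import Data.Vec.Properties using (lookup∘tabulate; tabulate∘lookup; tabulate-cong)
open import Relation.Binary using (Rel; Transitive; tri<; tri≈; tri>)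
import Relation.Binary as Binary
open import Relation.Binary.PropositionalEquality
open import Relation.Nullary using (Dec; yes; no; does; ¬_; contradiction)
open import Relation.Nullary.Decidable using (_×-dec_; _⊎-dec_; ¬?)
open import Relation.Unary using (Pred; Decidable; _⊆_; _∩_; U)
open import Relation.Unary.Properties using (_∪?_; _∩?_; ∁?; U?; ∅?)

count : ∀ {n} {P : Pred (Fin n) 0ℓ} → Decidable P → ℕ
count P? = countFin (does ∘ P?)

count-mono : ∀ {n} {P Q : Pred (Fin n) 0ℓ} (P? : Decidable P) (Q? : Decidable Q) →
             P ⊆ Q → count P? ≤ count Q?
count-mono {zero}  P? Q? P⊆Q = z≤n
count-mono {suc n} P? Q? P⊆Q with P? Fin.zero | Q? Fin.zero
... | yes _  | yes _  = s≤s (count-mono (P? ∘ Fin.suc) (Q? ∘ Fin.suc) P⊆Q)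
... | yes p₀ | no ¬q₀ = contradiction (P⊆Q p₀) ¬q₀
... | no _   | yes _  = m≤n⇒m≤1+n (count-mono (P? ∘ Fin.suc) (Q? ∘ Fin.suc) P⊆Q)
... | no _   | no _   = count-mono (P? ∘ Fin.suc) (Q? ∘ Fin.suc) P⊆Q

count-mono-< : ∀ {n} {P Q : Pred (Fin n) 0ℓ} (P? : Decidable P) (Q? : Decidable Q) →
               P ⊆ Q → ∀ {z} → ¬ P z → Q z → count P? < count Q?
count-mono-< {suc n} P? Q? P⊆Q {Fin.zero} ¬p₀ q₀ with P? Fin.zero | Q? Fin.zero
... | yes p₀ | _      = contradiction p₀ ¬p₀
... | no _   | no ¬q₀ = contradiction q₀ ¬q₀
... | no _   | yes _  = s≤s (count-mono (P? ∘ Fin.suc) (Q? ∘ Fin.suc) P⊆Q)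
count-mono-< {suc n} P? Q? P⊆Q {Fin.suc z} ¬pz qz with P? Fin.zero | Q? Fin.zero
... | yes _  | yes _  = s≤s (count-mono-< (P? ∘ Fin.suc) (Q? ∘ Fin.suc) P⊆Q ¬pz qz)
... | yes p₀ | no ¬q₀ = contradiction (P⊆Q p₀) ¬q₀
... | no _   | yes _  = m<n⇒m<1+n (count-mono-< (P? ∘ Fin.suc) (Q? ∘ Fin.suc) P⊆Q ¬pz qz)
... | no _   | no _   = count-mono-< (P? ∘ Fin.suc) (Q? ∘ Fin.suc) P⊆Q ¬pz qz

count-cong : ∀ {n} {P Q : Pred (Fin n) 0ℓ} (P? : Decidable P) (Q? : Decidable Q) →
             P ⊆ Q → Q ⊆ P → count P? ≡ count Q?
count-cong P? Q? P⊆Q Q⊆P = ≤-antisym (count-mono P? Q? P⊆Q) (count-mono Q? P? Q⊆P)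

count-∅ : ∀ {n} {P : Pred (Fin n) 0ℓ} (P? : Decidable P) → (∀ {x} → ¬ P x) → count P? ≡ 0
count-∅ {zero}  P? ¬P = refl
count-∅ {suc n} P? ¬P with P? Fin.zero
... | yes p₀ = contradiction p₀ ¬P
... | no _   = count-∅ (P? ∘ Fin.suc) ¬P

count-≤1 : ∀ {n} {P : Pred (Fin n) 0ℓ} (P? : Decidable P) →
           (∀ {x y} → P x → P y → x ≡ y) → count P? ≤ 1
count-≤1 {zero}  P? P-unique = z≤n
count-≤1 {suc n} P? P-unique with P? Fin.zero
... | yes p₀ = s≤s (≤-reflexive (count-∅ (P? ∘ Fin.suc) (Finₚ.0≢1+n ∘ P-unique p₀)))
... | no _   = count-≤1 (P? ∘ Fin.suc) (λ px py → Finₚ.suc-injective (P-unique px py))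

count-singleton : ∀ {n} {P : Pred (Fin n) 0ℓ} (P? : Decidable P) {z} →
                  P z → (∀ {y} → P y → y ≡ z) → count P? ≡ 1
count-singleton {n} P? pz P⊆z = ≤-antisym
  (count-≤1 P? (λ px py → trans (P⊆z px) (sym (P⊆z py))))
  (subst (_< count P?) (count-∅ {n} ∅? λ ()) (count-mono-< {n} ∅? P? (λ ()) (λ ()) pz))

count-≡ : ∀ {n} (z : Fin n) → count (Finₚ._≟ z) ≡ 1
count-≡ z = count-singleton (Finₚ._≟ z) refl (λ y≡z → y≡z)

count-≡∩< : ∀ {n} {w x : Fin n} → w Fin.< x → count ((Finₚ._≟ w) ∩? (Fin._<? x)) ≡ 1
count-≡∩< {w = w} {x} w<x = count-singleton ((Finₚ._≟ w) ∩? (Fin._<? x)) (refl , w<x) proj₁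

count-≡∩≮ : ∀ {n} {w x : Fin n} → ¬ w Fin.< x → count ((Finₚ._≟ w) ∩? (Fin._<? x)) ≡ 0
count-≡∩≮ {w = w} {x} w≮x = count-∅ ((Finₚ._≟ w) ∩? (Fin._<? x)) λ { (refl , w<x) → w≮x w<x }

count-∪ : ∀ {n} {P Q : Pred (Fin n) 0ℓ} (P? : Decidable P) (Q? : Decidable Q) →
          (∀ {x} → P x → ¬ Q x) → count (P? ∪? Q?) ≡ count P? + count Q?
count-∪ {zero}  P? Q? disjoint = refl
count-∪ {suc n} P? Q? disjoint
  with P? Fin.zero | Q? Fin.zero | count-∪ (P? ∘ Fin.suc) (Q? ∘ Fin.suc) disjoint
... | yes p₀ | yes q₀ | _  = contradiction q₀ (disjoint p₀)
... | yes _  | no _   | ih = cong suc ih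
... | no _   | yes _  | ih = trans (cong suc ih) (sym (+-suc _ _))
... | no _   | no _   | ih = ih

count-∁ : ∀ {n} {P : Pred (Fin n) 0ℓ} (P? : Decidable P) → count P? + count (∁? P?) ≡ n
count-∁ {zero}  P? = refl
count-∁ {suc n} P? with P? Fin.zero
... | yes _ = cong suc (count-∁ (P? ∘ Fin.suc))
... | no _  = trans (+-suc _ _) (cong suc (count-∁ (P? ∘ Fin.suc)))

count-U : ∀ {n} → count {n} U? ≡ n
count-U {zero}  = refl
count-U {suc n} = cong suc (count-U {n})

module Onto {n} {S : Pred (Fin n) 0ℓ} (S? : Decidable S) (f : Fin n → ℕ)
            (f-injective : ∀ {x y} → S x → S y → f x ≡ f y → x ≡ y) where

  below? : ∀ v → Decidable (S ∩ λ x → f x < v)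
  below? v = S? ∩? λ x → f x <? v

  hits? : ∀ v → Decidable (S ∩ λ x → f x ≡ v)
  hits? v = S? ∩? λ x → f x ≟ v

  below : ℕ → ℕ
  below = count ∘ below?

  hits : ℕ → ℕ
  hits = count ∘ hits?

  below-suc : ∀ v → below (suc v) ≡ below v + hits v
  below-suc v = trans (count-cong (below? (suc v)) (below? v ∪? hits? v) split join)
                      (count-∪ (below? v) (hits? v) λ (_ , fx<v) (_ , fx≡v) → <-irrefl fx≡v fx<v)
    where
    split : ∀ {x} → S x × f x < suc v → (S x × f x < v) ⊎ (S x × f x ≡ v)
    split (sx , fx<1+v) = Sum.map (sx ,_) (sx ,_) (m<1+n⇒m<n∨m≡n fx<1+v)
    join : ∀ {x} → (S x × f x < v) ⊎ (S x × f x ≡ v) → S x × f x < suc v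
    join (inj₁ (sx , fx<v))  = sx , m<n⇒m<1+n fx<v
    join (inj₂ (sx , refl)) = sx , ≤-refl

  hits-≤1 : ∀ v → hits v ≤ 1
  hits-≤1 v = count-≤1 (hits? v) λ (sx , fx≡v) (sy , fy≡v) → f-injective sx sy (trans fx≡v (sym fy≡v))

  below-≤ : ∀ v → below v ≤ v
  below-≤ zero    = ≤-reflexive (count-∅ (below? 0) λ ())
  below-≤ (suc v) = begin
    below (suc v)    ≡⟨ below-suc v ⟩
    below v + hits v ≤⟨ +-mono-≤ (below-≤ v) (hits-≤1 v) ⟩
    v + 1            ≡⟨ +-comm v 1 ⟩
    suc v            ∎
    where open ≤-Reasoning

  below-<-missed : ∀ {v₀} → (∀ {x} → S x → f x ≢ v₀) → ∀ {v} → v₀ < v → below v < v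
  below-<-missed missed {suc v} v₀<1+v with m<1+n⇒m<n∨m≡n v₀<1+v
  ... | inj₁ v₀<v = begin-strict
    below (suc v)    ≡⟨ below-suc v ⟩
    below v + hits v <⟨ +-mono-<-≤ (below-<-missed missed v₀<v) (hits-≤1 v) ⟩
    v + 1            ≡⟨ +-comm v 1 ⟩
    suc v            ∎
    where open ≤-Reasoning
  ... | inj₂ refl = begin-strict
    below (suc v)    ≡⟨ below-suc v ⟩
    below v + hits v ≡⟨ cong (below v +_) (count-∅ (hits? v) λ (sx , fx≡v) → missed sx fx≡v) ⟩
    below v + 0      ≡⟨ +-identityʳ _ ⟩
    below v          ≤⟨ below-≤ v ⟩
    v                <⟨ n<1+n v ⟩
    suc v            ∎
    where open ≤-Reasoning

  onto : ∀ {m} → (∀ {x} → S x → f x < m) → count S? ≡ m →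
         ∀ {v} → v < m → ∃ λ x → S x × f x ≡ v
  onto {m} f<m |S|≡m {v} v<m with Finₚ.any? (S? ∩? λ x → f x ≟ v)
  ... | yes (x , sx , fx≡v) = x , sx , fx≡v
  ... | no ¬hit = contradiction m<m (<-irrefl refl)
    where
    open ≤-Reasoning
    m<m : m < m
    m<m = begin-strict
      m        ≡⟨ |S|≡m ⟨
      count S? ≡⟨ count-cong S? (below? m) (λ sx → sx , f<m sx) proj₁ ⟩
      below m  <⟨ below-<-missed (λ sx fx≡v → ¬hit (_ , sx , fx≡v)) v<m ⟩
      m        ∎

module Rank {n} {S : Pred (Fin n) 0ℓ} (S? : Decidable S)
            {_≺_ : Rel (Fin n) 0ℓ} (_≺?_ : Binary.Decidable _≺_)
            (≺-trans : Transitive _≺_) (≺-irrefl : ∀ {x} → ¬ x ≺ x)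
            (≺-connex : ∀ {x y} → S x → S y → x ≢ y → x ≺ y ⊎ y ≺ x) where

  before? : ∀ x → Decidable (S ∩ (_≺ x))
  before? x = S? ∩? (_≺? x)

  rank : Fin n → ℕ
  rank = count ∘ before?

  rank-mono : ∀ {x y} → S x → x ≺ y → rank x < rank y
  rank-mono {x} {y} sx x≺y =
    count-mono-< (before? x) (before? y) (λ (sz , z≺x) → sz , ≺-trans z≺x x≺y) (≺-irrefl ∘ proj₂) (sx , x≺y)

  rank-< : ∀ {x} → S x → rank x < count S?
  rank-< {x} sx = count-mono-< (before? x) S? proj₁ (≺-irrefl ∘ proj₂) sx

  rank-injective : ∀ {x y} → S x → S y → rank x ≡ rank y → x ≡ y
  rank-injective {x} {y} sx sy rx≡ry with x Finₚ.≟ y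
  ... | yes x≡y = x≡y
  ... | no x≢y with ≺-connex sx sy x≢y
  ...   | inj₁ x≺y = contradiction rx≡ry (<⇒≢ (rank-mono sx x≺y))
  ...   | inj₂ y≺x = contradiction (sym rx≡ry) (<⇒≢ (rank-mono sy y≺x))

  rank-onto : ∀ {v} → v < count S? → ∃ λ x → S x × rank x ≡ v
  rank-onto = Onto.onto S? rank rank-injective rank-< refl

module StrictMono {A : Set} {P : Pred A 0ℓ} (f g : A → ℕ)
                  (f-injective : ∀ {x y} → P x → P y → f x ≡ f y → x ≡ y)
                  (f<⇒g< : ∀ {x y} → P x → P y → f x < f y → g x < g y) where

  f≤⇒g≤ : ∀ {x y} → P x → P y → f x ≤ f y → g x ≤ g y
  f≤⇒g≤ px py fx≤fy with m≤n⇒m<n∨m≡n fx≤fy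
  ... | inj₁ fx<fy = <⇒≤ (f<⇒g< px py fx<fy)
  ... | inj₂ fx≡fy = ≤-reflexive (cong g (f-injective px py fx≡fy))

  g<⇒f< : ∀ {x y} → P x → P y → g x < g y → f x < f y
  g<⇒f< px py gx<gy = ≰⇒> λ fy≤fx → <⇒≱ gx<gy (f≤⇒g≤ py px fy≤fx)

≢⇒<⊎> : ∀ {n} {x y : Fin n} → x ≢ y → x Fin.< y ⊎ y Fin.< x
≢⇒<⊎> {x = x} {y} x≢y with Finₚ.<-cmp x y
... | tri< x<y _ _ = inj₁ x<y
... | tri≈ _ x≡y _ = contradiction x≡y x≢y
... | tri> _ _ y<x = inj₂ y<x

lex-< : ∀ {a b r s m} → a < b → r < m → a * m + r < b * m + s
lex-< {a} {b} {r} {s} {m} a<b r<m = begin-strict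
  a * m + r <⟨ +-monoʳ-< (a * m) r<m ⟩
  a * m + m ≡⟨ +-comm (a * m) m ⟩
  suc a * m ≤⟨ *-monoˡ-≤ m a<b ⟩
  b * m     ≤⟨ m≤m+n (b * m) s ⟩
  b * m + s ∎
  where open ≤-Reasoning

sortingPermutation : ∀ {n} (key : Fin n → ℕ) →
  Σ (Permutation′ n) λ σ → ∀ {x y} → key x < key y → σ ⟨$⟩ʳ x Fin.< σ ⟨$⟩ʳ y
sortingPermutation {n} key = σ , σ-mono
  where
  -- ties of key are broken by position, so key′ is injective
  key′ : Fin n → ℕ
  key′ x = key x * n + toℕ x

  key′-mono : ∀ {x y} → key x < key y → key′ x < key′ y
  key′-mono {x} kx<ky = lex-< kx<ky (Finₚ.toℕ<n x)

  key′-injective : ∀ {x y} → key′ x ≡ key′ y → x ≡ y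
  key′-injective {x} {y} eq with <-cmp (key x) (key y)
  ... | tri< kx<ky _ _ = contradiction eq (<⇒≢ (key′-mono kx<ky))
  ... | tri> _ _ ky<kx = contradiction (sym eq) (<⇒≢ (key′-mono ky<kx))
  ... | tri≈ _ kx≡ky _ =
    Finₚ.toℕ-injective (+-cancelˡ-≡ (key x * n) _ _ (trans eq (cong (λ k → k * n + toℕ y) (sym kx≡ky))))

  key′-connex : ∀ {x y} → U x → U y → x ≢ y → key′ x < key′ y ⊎ key′ y < key′ x
  key′-connex {x} {y} _ _ x≢y with <-cmp (key′ x) (key′ y)
  ... | tri< lt _ _ = inj₁ lt
  ... | tri≈ _ eq _ = contradiction (key′-injective eq) x≢y
  ... | tri> _ _ gt = inj₂ gt

  open Rank U? {_<_ on key′} (λ x y → key′ x <? key′ y) <-trans (<-irrefl refl) key′-connex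

  rank<n : ∀ x → rank x < n
  rank<n x = subst (rank x <_) count-U (rank-< tt)

  unrank : Fin n → Fin n
  unrank i = proj₁ (rank-onto (subst (toℕ i <_) (sym count-U) (Finₚ.toℕ<n i)))

  rank-unrank : ∀ i → rank (unrank i) ≡ toℕ i
  rank-unrank i = proj₂ (proj₂ (rank-onto (subst (toℕ i <_) (sym count-U) (Finₚ.toℕ<n i))))

  σ : Permutation′ n
  σ = permutation (λ x → fromℕ< (rank<n x)) unrank
    (λ i → Finₚ.toℕ-injective (trans (Finₚ.toℕ-fromℕ< (rank<n (unrank i))) (rank-unrank i)))
    (λ x → rank-injective tt tt (trans (rank-unrank _) (Finₚ.toℕ-fromℕ< (rank<n x))))

  σ-mono : ∀ {x y} → key x < key y → σ ⟨$⟩ʳ x Fin.< σ ⟨$⟩ʳ y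
  σ-mono {x} {y} kx<ky = subst₂ _<_ (sym (Finₚ.toℕ-fromℕ< (rank<n x))) (sym (Finₚ.toℕ-fromℕ< (rank<n y)))
                                    (rank-mono tt (key′-mono kx<ky))

⟨$⟩ʳ-injective : ∀ {ℓ} (p : Permutation′ ℓ) {a b} → p ⟨$⟩ʳ a ≡ p ⟨$⟩ʳ b → a ≡ b
⟨$⟩ʳ-injective p {a} {b} eq = begin
  a                     ≡⟨ inverseˡ p ⟨
  p ⟨$⟩ˡ (p ⟨$⟩ʳ a)     ≡⟨ cong (p ⟨$⟩ˡ_) eq ⟩
  p ⟨$⟩ˡ (p ⟨$⟩ʳ b)     ≡⟨ inverseˡ p ⟩
  b                     ∎
  where open ≡-Reasoning

pAt-toℕ : ∀ {ℓ} (p : Permutation′ ℓ) (a : Fin ℓ) → pAt p (toℕ a) ≡ toℕ (p ⟨$⟩ʳ a)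
pAt-toℕ {ℓ} p a with toℕ a <? ℓ
... | yes a<ℓ = cong (λ b → toℕ (p ⟨$⟩ʳ b)) (Finₚ.fromℕ<-toℕ a a<ℓ)
... | no a≮ℓ  = contradiction (Finₚ.toℕ<n a) a≮ℓ

pAt-< : ∀ {m} (p : Permutation′ (suc m)) a → pAt p a < suc m
pAt-< {m} p a with a <? suc m
... | yes _ = Finₚ.toℕ<n _
... | no _  = s≤s z≤n

pAt-injective : ∀ {ℓ} (p : Permutation′ ℓ) {a b} → a < ℓ → b < ℓ → pAt p a ≡ pAt p b → a ≡ b
pAt-injective p {a} {b} a<ℓ b<ℓ eq = begin
  a                ≡⟨ Finₚ.toℕ-fromℕ< a<ℓ ⟨
  toℕ (fromℕ< a<ℓ) ≡⟨ cong toℕ (⟨$⟩ʳ-injective p (Finₚ.toℕ-injective p-eq)) ⟩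
  toℕ (fromℕ< b<ℓ) ≡⟨ Finₚ.toℕ-fromℕ< b<ℓ ⟩
  b                ∎
  where
  open ≡-Reasoning
  pAt-fromℕ< : ∀ {c} (c<ℓ : c < _) → toℕ (p ⟨$⟩ʳ fromℕ< c<ℓ) ≡ pAt p c
  pAt-fromℕ< c<ℓ = trans (sym (pAt-toℕ p _)) (cong (pAt p) (Finₚ.toℕ-fromℕ< c<ℓ))
  p-eq : toℕ (p ⟨$⟩ʳ fromℕ< a<ℓ) ≡ toℕ (p ⟨$⟩ʳ fromℕ< b<ℓ)
  p-eq = trans (pAt-fromℕ< a<ℓ) (trans eq (sym (pAt-fromℕ< b<ℓ)))

count-∈ : ∀ {n} (H : Subset n) → count (_∈? H) ≡ ∣ H ∣
count-∈ []            = refl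
count-∈ (inside ∷ H)  = cong suc (count-∈ H)
count-∈ (outside ∷ H) = count-∈ H

count-∉ : ∀ {n} (H : Subset n) → count (∁? (_∈? H)) ≡ n ∸ ∣ H ∣
count-∉ {n} H = begin
  count (∁? (_∈? H))                         ≡⟨ m+n∸m≡n ∣ H ∣ _ ⟨
  ∣ H ∣ + count (∁? (_∈? H)) ∸ ∣ H ∣         ≡⟨ cong (λ h → h + count (∁? (_∈? H)) ∸ ∣ H ∣) (count-∈ H) ⟨
  count (_∈? H) + count (∁? (_∈? H)) ∸ ∣ H ∣ ≡⟨ cong (_∸ ∣ H ∣) (count-∁ (_∈? H)) ⟩
  n ∸ ∣ H ∣                                  ∎
  where open ≡-Reasoning

holesBefore? : ∀ {n} (H : Subset n) (x : Fin n) → Decidable ((_∈ H) ∩ (Fin._< x))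
holesBefore? H x = (_∈? H) ∩? (Fin._<? x)

gap-mono : ∀ {n} (H : Subset n) {x y} → x Fin.< y → gap H x ≤ gap H y
gap-mono H {x} {y} x<y =
  count-mono (holesBefore? H x) (holesBefore? H y) λ (z∈H , z<x) → z∈H , <-trans z<x x<y

gap-mono-∈ : ∀ {n} (H : Subset n) {x y} → x ∈ H → x Fin.< y → gap H x < gap H y
gap-mono-∈ H {x} {y} x∈H x<y = count-mono-< (holesBefore? H x) (holesBefore? H y)
  (λ (z∈H , z<x) → z∈H , <-trans z<x x<y) (λ (_ , x<x) → <-irrefl refl x<x) (x∈H , x<y)

gap-≤ : ∀ {n} (H : Subset n) x → gap H x ≤ ∣ H ∣
gap-≤ H x = subst (gap H x ≤_) (count-∈ H) (count-mono (holesBefore? H x) (_∈? H) proj₁)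

gap-<-∈ : ∀ {n} (H : Subset n) {x} → x ∈ H → gap H x < ∣ H ∣
gap-<-∈ H {x} x∈H = subst (gap H x <_) (count-∈ H)
  (count-mono-< (holesBefore? H x) (_∈? H) proj₁ (λ (_ , x<x) → <-irrefl refl x<x) x∈H)

stdRestr-< : ∀ {n} (σ : Permutation′ n) (H : Subset n) {x y} →
             stdRestr σ H x < stdRestr σ H y → σ ⟨$⟩ʳ x Fin.< σ ⟨$⟩ʳ y
stdRestr-< σ H {x} {y} std<std = ≰⇒> λ σy≤σx → <⇒≱ std<std
  (count-mono (below? y) (below? x) λ (j∉H , σj≤σy) → j∉H , ≤-trans σj≤σy σy≤σx)
  where
  below? : ∀ i j → Dec (j ∉ H × toℕ (σ ⟨$⟩ʳ j) ≤ toℕ (σ ⟨$⟩ʳ i))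
  below? i = ∁? (_∈? H) ∩? λ j → toℕ (σ ⟨$⟩ʳ j) ≤? toℕ (σ ⟨$⟩ʳ i)

clamp : ∀ {m} → ℕ → Fin (suc m)
clamp {m} t = fromℕ< (s≤s (m⊓n≤n t m))

toℕ-clamp : ∀ {m t} → t ≤ m → toℕ (clamp {m} t) ≡ t
toℕ-clamp t≤m = trans (Finₚ.toℕ-fromℕ< _) (m≤n⇒m⊓n≡m t≤m)

module Crossing (M : ℕ) (G : ℕ → ℕ) (B : ℕ → Set)
                (G-mono : ∀ {t} → t < M → G t ≤ G (suc t))
                (G-jump : ∀ {t} → t < M → B t → G t < G (suc t)) where

  crossing : ∀ e {t} → t ≤ M → t ≤ e + G t → (M ≤ e + G M → ¬ B M × e + G M ≡ M) →
             ∃ λ s → t ≤ s × s ≤ M × ¬ B s × e + G s ≡ s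
  crossing e {t} t≤M t≤G stop = go (M ∸ t) (m∸n+n≡m t≤M) t≤G
    where
    go : ∀ d {t} → d + t ≡ M → t ≤ e + G t → ∃ λ s → t ≤ s × s ≤ M × ¬ B s × e + G s ≡ s
    go zero refl t≤G = let ¬BM , e+GM≡M = stop t≤G in _ , ≤-refl , ≤-refl , ¬BM , e+GM≡M
    go (suc d) {t} 1+d+t≡M t≤G with suc t ≤? e + G (suc t)
    ... | yes 1+t≤G = let s , 1+t≤s , rest = go d (trans (+-suc d t) 1+d+t≡M) 1+t≤G
                      in s , <⇒≤ 1+t≤s , rest
    ... | no 1+t≰G = t , ≤-refl , <⇒≤ t<M , ¬Bt , ≤-antisym e+Gt≤t t≤G
      where
      t<M : t < M
      t<M = subst (t <_) 1+d+t≡M (s≤s (m≤n+m t d))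
      G′≤t : e + G (suc t) ≤ t
      G′≤t = ≤-pred (≰⇒> 1+t≰G)
      e+Gt≤t : e + G t ≤ t
      e+Gt≤t = ≤-trans (+-monoʳ-≤ e (G-mono t<M)) G′≤t
      ¬Bt : ¬ B t
      ¬Bt Bt = <⇒≱ (≤-trans (+-monoʳ-< e (G-jump t<M Bt)) G′≤t) t≤G

  twoCrossings : G M < M → (B M → suc (G M) < M) →
                 ∃₂ λ r s → r < s × s ≤ M × ¬ B r × ¬ B s × G r ≡ r × suc (G s) ≡ s
  twoCrossings GM<M BM⇒1+GM<M with crossing 0 z≤n z≤n (λ M≤GM → contradiction GM<M (≤⇒≯ M≤GM))
  ... | r , _ , r≤M , ¬Br , Gr≡r with crossing 1 {suc r} r<M (s≤s r≤G) stop
    where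
    r<M : r < M
    r<M = ≤∧≢⇒< r≤M λ r≡M → <-irrefl (trans (cong G (sym r≡M)) (trans Gr≡r r≡M)) GM<M
    r≤G : r ≤ G (suc r)
    r≤G = subst (_≤ G (suc r)) Gr≡r (G-mono r<M)
    stop : M ≤ suc (G M) → ¬ B M × suc (G M) ≡ M
    stop M≤1+GM = (λ BM → <⇒≱ (BM⇒1+GM<M BM) M≤1+GM) , ≤-antisym GM<M M≤1+GM
  ... | s , r<s , s≤M , ¬Bs , 1+Gs≡s = r , s , r<s , s≤M , ¬Br , ¬Bs , Gr≡r , 1+Gs≡s

value : ∀ {n} → Vec (Maybe ℕ) n → Fin n → ℕ
value π x = fromMaybe 0 (lookup π x)

module PartialPerm {n k} {H : Subset n} {π : Vec (Maybe ℕ) n} (π-pp : IsPartialPerm k H π) where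

  lookup-∉ : ∀ {x} → x ∉ H → lookup π x ≡ just (value π x)
  lookup-∉ {x} x∉H with lookup π x in πx≡
  ... | just _  = refl
  ... | nothing = contradiction (proj₂ (proj₁ π-pp x) πx≡) x∉H

  value-range : ∀ {x} → x ∉ H → 1 ≤ value π x × value π x ≤ n ∸ k
  value-range x∉H = proj₁ (proj₂ π-pp) _ _ (lookup-∉ x∉H)

  value-injective : ∀ {x y} → x ∉ H → y ∉ H → value π x ≡ value π y → x ≡ y
  value-injective {x} {y} x∉H y∉H Wx≡Wy =
    let 1≤Wx , Wx≤N = value-range x∉H
        _ , _ , unique = proj₂ (proj₂ π-pp) (value π x) 1≤Wx Wx≤N
    in trans (unique x (lookup-∉ x∉H)) (sym (unique y (trans (lookup-∉ y∉H) (cong just (sym Wx≡Wy)))))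

  open Onto (∁? (_∈? H)) (value π) value-injective using (below; hits?; below-suc)

  hits≡1 : ∀ {v} → 1 ≤ v → v ≤ n ∸ k → count (hits? v) ≡ 1
  hits≡1 {v} 1≤v v≤N with proj₂ (proj₂ π-pp) v 1≤v v≤N
  ... | i , πi≡v , unique = count-singleton (hits? v) (i∉H , cong (fromMaybe 0) πi≡v)
                              λ (y∉H , Wy≡v) → unique _ (trans (lookup-∉ y∉H) (cong just Wy≡v))
    where
    i∉H : i ∉ H
    i∉H i∈H = case trans (sym πi≡v) (proj₁ (proj₁ π-pp i) i∈H) of λ ()

  count-value-< : ∀ {v} → v ≤ n ∸ k → below (suc v) ≡ v
  count-value-< {zero}  _ = count-∅ (∁? (_∈? H) ∩? λ x → value π x <? 1)
                                    λ (x∉H , Wx<1) → <⇒≱ Wx<1 (proj₁ (value-range x∉H))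
  count-value-< {suc v} 1+v≤N = begin
    below (suc (suc v))                   ≡⟨ below-suc (suc v) ⟩
    below (suc v) + count (hits? (suc v)) ≡⟨ cong₂ _+_ (count-value-< (≤-trans (n≤1+n v) 1+v≤N))
                                                       (hits≡1 (s≤s z≤n) 1+v≤N) ⟩
    v + 1                                 ≡⟨ +-comm v 1 ⟩
    suc v                                 ∎
    where open ≡-Reasoning

  value≡1+below : ∀ {x} → x ∉ H → value π x ≡ suc (below (value π x))
  value≡1+below {x} x∉H with value π x | value-range x∉H
  ... | suc w | _ , 1+w≤N = cong suc (sym (count-value-< (<⇒≤ 1+w≤N)))

≡-fromOrder : ∀ {n k} {H : Subset n} {π π′ : Vec (Maybe ℕ) n} →
              IsPartialPerm k H π → IsPartialPerm k H π′ →
              (∀ {x y} → x ∉ H → y ∉ H → value π x < value π y → value π′ x < value π′ y) →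
              π ≡ π′
≡-fromOrder {k = k} {H} {π} {π′} π-pp π′-pp W<⇒W′< = begin
  π                    ≡⟨ tabulate∘lookup π ⟨
  tabulate (lookup π)  ≡⟨ tabulate-cong lookup-≡ ⟩
  tabulate (lookup π′) ≡⟨ tabulate∘lookup π′ ⟩
  π′                   ∎
  where
  open ≡-Reasoning
  module P  = PartialPerm {k = k} {π = π} π-pp
  module P′ = PartialPerm {k = k} {π = π′} π′-pp
  open StrictMono (value π) (value π′) P.value-injective W<⇒W′< using (g<⇒f<)

  lookup-≡ : ∀ i → lookup π i ≡ lookup π′ i
  lookup-≡ i with i ∈? H
  ... | yes i∈H = trans (proj₁ (proj₁ π-pp i) i∈H) (sym (proj₁ (proj₁ π′-pp i) i∈H))
  ... | no i∉H  = begin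
    lookup π i ≡⟨ P.lookup-∉ i∉H ⟩
    just (value π i) ≡⟨ cong just (P.value≡1+below i∉H) ⟩
    just (suc (count (∁? (_∈? H) ∩? λ y → value π y <? value π i)))
      ≡⟨ cong (just ∘ suc) (count-cong (∁? (_∈? H) ∩? λ y → value π y <? value π i)
                                         (∁? (_∈? H) ∩? λ y → value π′ y <? value π′ i)
                             (λ (y∉H , lt) → y∉H , W<⇒W′< y∉H i∉H lt)
                             (λ (y∉H , lt) → y∉H , g<⇒f< y∉H i∉H lt)) ⟩
    just (suc (count (∁? (_∈? H) ∩? λ y → value π′ y <? value π′ i)))
      ≡⟨ cong just (P′.value≡1+below i∉H) ⟨
    just (value π′ i) ≡⟨ P′.lookup-∉ i∉H ⟨
    lookup π′ i ∎

fill : ∀ {n} → Subset n → (Fin n → ℕ) → Fin n → Maybe ℕ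
fill H w x with x ∈? H
... | yes _ = nothing
... | no _  = just (w x)

fill-∈ : ∀ {n} {H : Subset n} {w x} → x ∈ H → fill H w x ≡ nothing
fill-∈ {H = H} {x = x} x∈H with x ∈? H
... | yes _   = refl
... | no x∉H  = contradiction x∈H x∉H

fill-∉ : ∀ {n} {H : Subset n} {w x} → x ∉ H → fill H w x ≡ just (w x)
fill-∉ {H = H} {x = x} x∉H with x ∈? H
... | yes x∈H = contradiction x∈H x∉H
... | no _    = refl

fill-just : ∀ {n} {H : Subset n} {w x v} → fill H w x ≡ just v → x ∉ H × w x ≡ v
fill-just {H = H} {x = x} with x ∈? H
... | yes _   = λ ()
... | no x∉H  = λ { refl → x∉H , refl }

tabulate-fill-isPartialPerm : ∀ {n k} (H : Subset n) (w : Fin n → ℕ) →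
  (∀ {x} → x ∉ H → 1 ≤ w x × w x ≤ n ∸ k) →
  (∀ {x y} → x ∉ H → y ∉ H → w x ≡ w y → x ≡ y) →
  (∀ {v} → 1 ≤ v → v ≤ n ∸ k → ∃ λ x → x ∉ H × w x ≡ v) →
  IsPartialPerm k H (tabulate (fill H w))
tabulate-fill-isPartialPerm {n} {k} H w w-range w-injective w-onto = holes , range , onto
  where
  entry : ∀ i → lookup (tabulate (fill H w)) i ≡ fill H w i
  entry = lookup∘tabulate (fill H w)

  holes : ∀ i → (i ∈ H → lookup (tabulate (fill H w)) i ≡ nothing) ×
                (lookup (tabulate (fill H w)) i ≡ nothing → i ∈ H)
  holes i = (λ i∈H → trans (entry i) (fill-∈ i∈H)) , nothing⇒∈
    where
    nothing⇒∈ : lookup (tabulate (fill H w)) i ≡ nothing → i ∈ H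
    nothing⇒∈ πi≡ with i ∈? H
    ... | yes i∈H = i∈H
    ... | no i∉H  = case trans (sym πi≡) (trans (entry i) (fill-∉ i∉H)) of λ ()

  range : ∀ i v → lookup (tabulate (fill H w)) i ≡ just v → 1 ≤ v × v ≤ n ∸ k
  range i v πi≡v = let i∉H , wi≡v = fill-just (trans (sym (entry i)) πi≡v)
                   in subst (λ u → 1 ≤ u × u ≤ n ∸ k) wi≡v (w-range i∉H)

  onto : ∀ v → 1 ≤ v → v ≤ n ∸ k → Σ (Fin n) λ i →
         lookup (tabulate (fill H w)) i ≡ just v × (∀ j → lookup (tabulate (fill H w)) j ≡ just v → j ≡ i)
  onto v 1≤v v≤N = let i , i∉H , wi≡v = w-onto 1≤v v≤N in
    i , trans (entry i) (trans (fill-∉ i∉H) (cong just wi≡v)) , λ j πj≡v →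
      let j∉H , wj≡v = fill-just (trans (sym (entry j)) πj≡v)
      in w-injective j∉H i∉H (trans wj≡v (sym wi≡v))

module OrderGraph {k n} (p : Permutation′ (suc (suc k))) (H : Subset n) (∣H∣≡k : ∣ H ∣ ≡ k) where

  gap≤k : ∀ x → gap H x ≤ k
  gap≤k x = subst (gap H x ≤_) ∣H∣≡k (gap-≤ H x)

  Edge? : ∀ x y → Dec (Edge p H x y)
  Edge? x y = ¬? (x ∈? H) ×-dec ¬? (y ∈? H) ×-dec
    ((x Fin.<? y ×-dec pAt p (suc (gap H y)) <? pAt p (gap H x)) ⊎-dec
     (y Fin.<? x ×-dec pAt p (gap H y) <? pAt p (suc (gap H x))))

  Edge-irrefl : ∀ {x} → ¬ Edge p H x x
  Edge-irrefl (_ , _ , inj₁ (x<x , _)) = <-irrefl refl x<x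
  Edge-irrefl (_ , _ , inj₂ (x<x , _)) = <-irrefl refl x<x

  Edge⇒≢ : ∀ {x y} → Edge p H x y → x ≢ y
  Edge⇒≢ x→y refl = Edge-irrefl x→y

  Edge-asym : ∀ {x y} → Edge p H x y → ¬ Edge p H y x
  Edge-asym (_ , _ , inj₁ (x<y , _)) (_ , _ , inj₁ (y<x , _)) = <-asym x<y y<x
  Edge-asym (_ , _ , inj₁ (_ , lt)) (_ , _ , inj₂ (_ , gt)) = <-asym lt gt
  Edge-asym (_ , _ , inj₂ (_ , lt)) (_ , _ , inj₁ (_ , gt)) = <-asym lt gt
  Edge-asym (_ , _ , inj₂ (y<x , _)) (_ , _ , inj₂ (x<y , _)) = <-asym y<x x<y

  Edge-orient : ∀ {x y} → x ∉ H → y ∉ H → x Fin.< y → Edge p H x y ⊎ Edge p H y x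
  Edge-orient {x} {y} x∉H y∉H x<y with <-cmp (pAt p (suc (gap H y))) (pAt p (gap H x))
  ... | tri< lt _ _ = inj₁ (x∉H , y∉H , inj₁ (x<y , lt))
  ... | tri> _ _ gt = inj₂ (y∉H , x∉H , inj₂ (x<y , gt))
  ... | tri≈ _ eq _ = contradiction (s≤s (gap-mono H x<y))
    (<-irrefl (sym (pAt-injective p (s≤s (s≤s (gap≤k y))) (s≤s (m≤n⇒m≤1+n (gap≤k x))) eq)))

  Edge-connex : ∀ {x y} → x ∉ H → y ∉ H → x ≢ y → Edge p H x y ⊎ Edge p H y x
  Edge-connex x∉H y∉H x≢y with ≢⇒<⊎> x≢y
  ... | inj₁ x<y = Edge-orient x∉H y∉H x<y
  ... | inj₂ y<x = Sum.swap (Edge-orient y∉H x∉H y<x)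

  Edge∘Edge⇒≢ : ∀ {x y z} → Edge p H x y → Edge p H y z → x ≢ z
  Edge∘Edge⇒≢ x→y y→z refl = Edge-asym x→y y→z

  Edge-trans : ¬ HasDirectedCycleOfLength 3 p H → Transitive (Edge p H)
  Edge-trans no3 {x} {y} {z} x→y y→z
    with Edge-connex (proj₁ x→y) (proj₁ (proj₂ y→z)) (Edge∘Edge⇒≢ x→y y→z)
  ... | inj₁ x→z = x→z
  ... | inj₂ z→x = contradiction (x ∷ y ∷ z ∷ [] , refl , distinct , x→y , y→z , z→x) no3
    where
    distinct : Unique (x ∷ y ∷ z ∷ [])
    distinct = (Edge⇒≢ x→y ∷ Edge∘Edge⇒≢ x→y y→z ∷ []) ∷ (Edge⇒≢ y→z ∷ []) ∷ [] ∷ []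

  path⇒Edge : ¬ HasDirectedCycleOfLength 3 p H → ∀ {v} us {w} → PathTo p H v us w → Edge p H v w
  path⇒Edge no3 []       v→w           = v→w
  path⇒Edge no3 (u ∷ us) (v→u , u⇝w) = Edge-trans no3 v→u (path⇒Edge no3 us u⇝w)

  acyclic⇔no-3-cycle : (¬ HasDirectedCycle p H) ⇔ (¬ HasDirectedCycleOfLength 3 p H)
  acyclic⇔no-3-cycle = mk⇔ (λ acyclic (cs , _ , cycle) → acyclic (cs , cycle)) no-3-cycle⇒acyclic
    where
    no-3-cycle⇒acyclic : ¬ HasDirectedCycleOfLength 3 p H → ¬ HasDirectedCycle p H
    no-3-cycle⇒acyclic no3 ([] , ())
    no-3-cycle⇒acyclic no3 (v ∷ vs , _ , v⇝v) = Edge-irrefl (path⇒Edge no3 vs v⇝v)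

  Respects : (Fin n → ℕ) → Set
  Respects w = ∀ {x y} → Edge p H x y → w x < w y

  respects⇒acyclic : ∀ {w} → Respects w → ¬ HasDirectedCycle p H
  respects⇒acyclic {w} respects ([] , ())
  respects⇒acyclic {w} respects (v ∷ vs , _ , v⇝v) = <-irrefl refl (increasing vs v⇝v)
    where
    increasing : ∀ {x} us {y} → PathTo p H x us y → w x < w y
    increasing []       x→y          = respects x→y
    increasing (u ∷ us) (x→u , u⇝y) = <-trans (respects x→u) (increasing us u⇝y)

  respects-order : ∀ {w w′} → Respects w → Respects w′ →
                   ∀ {x y} → x ∉ H → y ∉ H → w x < w y → w′ x < w′ y
  respects-order respects respects′ x∉H y∉H wx<wy with Edge-connex x∉H y∉H (<⇒≢ wx<wy ∘ cong _)
  ... | inj₁ x→y = respects′ x→y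
  ... | inj₂ y→x = contradiction (respects y→x) (<⇒≯ wx<wy)

  -- An increasing c : Fin ℓ → Fin n meets at most ℓ − 2 holes, so t ↦ g(c t) must cross the
  -- diagonal twice: at a non-hole with g(c r) = r and at a later non-hole with g(c s) + 1 = s.
  module Occurrence (c : Fin (suc (suc k)) → Fin n) (c-mono : ∀ a b → a Fin.< b → c a Fin.< c b) where

    pos : ℕ → Fin n
    pos t = c (clamp t)

    pos-mono : ∀ {t} → t < suc k → pos t Fin.< pos (suc t)
    pos-mono {t} t<M = c-mono (clamp t) (clamp (suc t))
      (subst₂ _<_ (sym (toℕ-clamp (<⇒≤ t<M))) (sym (toℕ-clamp t<M)) (n<1+n t))

    open Crossing (suc k) (gap H ∘ pos) (λ t → pos t ∈ H)
      (λ t<M → gap-mono H (pos-mono t<M)) (λ t<M t∈H → gap-mono-∈ H t∈H (pos-mono t<M))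

    DiagonalPair : Fin (suc (suc k)) → Fin (suc (suc k)) → Set
    DiagonalPair R S = R Fin.< S × c R ∉ H × c S ∉ H × gap H (c R) ≡ toℕ R × suc (gap H (c S)) ≡ toℕ S

    diagonalPair : ∃₂ DiagonalPair
    diagonalPair =
      let r , s , r<s , s≤M , r∉H , s∉H , Gr≡r , 1+Gs≡s =
            twoCrossings (s≤s (gap≤k (pos (suc k))))
                         (λ M∈H → s≤s (subst (gap H (pos (suc k)) <_) ∣H∣≡k (gap-<-∈ H M∈H)))
      in clamp r , clamp s , clamped r<s s≤M r∉H s∉H Gr≡r 1+Gs≡s
      where
      clamped : ∀ {r s} → r < s → s ≤ suc k → pos r ∉ H → pos s ∉ H →
                gap H (pos r) ≡ r → suc (gap H (pos s)) ≡ s → DiagonalPair (clamp r) (clamp s)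
      clamped {r} {s} r<s s≤M r∉H s∉H Gr≡r 1+Gs≡s =
        subst₂ _<_ (sym toℕR) (sym toℕS) r<s , r∉H , s∉H , trans Gr≡r (sym toℕR) , trans 1+Gs≡s (sym toℕS)
        where
        toℕR : toℕ (clamp {suc k} r) ≡ r
        toℕR = toℕ-clamp (<⇒≤ (<-≤-trans r<s s≤M))
        toℕS : toℕ (clamp {suc k} s) ≡ s
        toℕS = toℕ-clamp s≤M

  -- The edge between the two positions of diagonalPair is decided by the same letters of p
  -- that the occurrence compares.
  respects⇒avoids : ∀ π → Respects (value π) → AvoidsPartial H π p
  respects⇒avoids π respects σ σ-ext (c , c-mono , c-iso) = impossible (proj₂ (proj₂ diagonalPair))
    where
    open Occurrence c c-mono using (DiagonalPair; diagonalPair)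

    Edge⇒σ< : ∀ {x y} → Edge p H x y → σ ⟨$⟩ʳ x Fin.< σ ⟨$⟩ʳ y
    Edge⇒σ< {x} {y} x→y@(x∉H , y∉H , _) = stdRestr-< σ H
      (subst₂ _<_ (cong (fromMaybe 0) (σ-ext x x∉H)) (cong (fromMaybe 0) (σ-ext y y∉H)) (respects x→y))

    impossible : ∀ {R S} → DiagonalPair R S → ⊥
    impossible {R} {S} (R<S , x∉H , y∉H , gx≡R , 1+gy≡S) = compare (Finₚ.<-cmp (p ⟨$⟩ʳ R) (p ⟨$⟩ʳ S))
      where
      x<y : c R Fin.< c S
      x<y = c-mono R S R<S

      pR : pAt p (gap H (c R)) ≡ toℕ (p ⟨$⟩ʳ R)
      pR = trans (cong (pAt p) gx≡R) (pAt-toℕ p R)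
      pS : pAt p (suc (gap H (c S))) ≡ toℕ (p ⟨$⟩ʳ S)
      pS = trans (cong (pAt p) 1+gy≡S) (pAt-toℕ p S)

      compare : Binary.Tri (p ⟨$⟩ʳ R Fin.< p ⟨$⟩ʳ S) (p ⟨$⟩ʳ R ≡ p ⟨$⟩ʳ S) (p ⟨$⟩ʳ S Fin.< p ⟨$⟩ʳ R) → ⊥
      compare (tri< pR<pS _ _) = <-asym (proj₁ (c-iso R S) pR<pS)
        (Edge⇒σ< (y∉H , x∉H , inj₂ (x<y , subst₂ _<_ (sym pR) (sym pS) pR<pS)))
      compare (tri> _ _ pS<pR) = <-asym (proj₁ (c-iso S R) pS<pR)
        (Edge⇒σ< (x∉H , y∉H , inj₁ (x<y , subst₂ _<_ (sym pS) (sym pR) pS<pR)))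
      compare (tri≈ _ pR≡pS _) = <⇒≢ R<S (cong toℕ (⟨$⟩ʳ-injective p pR≡pS))

  module Inversion {π : Vec (Maybe ℕ) n} (π-pp : IsPartialPerm k H π)
                   {u v : Fin n} (u→v : Edge p H u v) (Wv<Wu : value π v < value π u) where

    open PartialPerm {k = k} {π = π} π-pp

    W : Fin n → ℕ
    W = value π

    u∉H : u ∉ H
    u∉H = proj₁ u→v
    v∉H : v ∉ H
    v∉H = proj₁ (proj₂ u→v)

    ∈⇒≢∉ : ∀ {x y} → x ∈ H → y ∉ H → x ≢ y
    ∈⇒≢∉ x∈H y∉H refl = y∉H x∈H

    Marked : Pred (Fin n) 0ℓ
    Marked x = x ∈ H ⊎ x ≡ u ⊎ x ≡ v

    marked? : Decidable Marked
    marked? = (_∈? H) ∪? ((Finₚ._≟ u) ∪? (Finₚ._≟ v))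

    count-marked : count marked? ≡ suc (suc k)
    count-marked = begin
      count marked?                                             ≡⟨ count-∪ (_∈? H) ((Finₚ._≟ u) ∪? (Finₚ._≟ v)) hole≢u,v ⟩
      count (_∈? H) + count ((Finₚ._≟ u) ∪? (Finₚ._≟ v))       ≡⟨ cong₂ _+_ (trans (count-∈ H) ∣H∣≡k)
                                                                  (count-∪ (Finₚ._≟ u) (Finₚ._≟ v) u≢v) ⟩
      k + (count (Finₚ._≟ u) + count (Finₚ._≟ v))               ≡⟨ cong (k +_) (cong₂ _+_ (count-≡ u) (count-≡ v)) ⟩
      k + 2                                                     ≡⟨ +-comm k 2 ⟩
      suc (suc k)                                               ∎
      where
      open ≡-Reasoning
      hole≢u,v : ∀ {x} → x ∈ H → ¬ (x ≡ u ⊎ x ≡ v)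
      hole≢u,v x∈H (inj₁ x≡u) = ∈⇒≢∉ x∈H u∉H x≡u
      hole≢u,v x∈H (inj₂ x≡v) = ∈⇒≢∉ x∈H v∉H x≡v
      u≢v : ∀ {x} → x ≡ u → x ≢ v
      u≢v x≡u x≡v = Edge⇒≢ u→v (trans (sym x≡u) x≡v)

    open Rank marked? Fin._<?_ Finₚ.<-trans (Finₚ.<-irrefl refl) (λ _ _ → ≢⇒<⊎>)

    rank<ℓ : ∀ {x} → Marked x → rank x < suc (suc k)
    rank<ℓ {x} mx = subst (rank x <_) count-marked (rank-< mx)

    Pair : Fin n → Fin n → Set
    Pair x y = (x ≡ u × y ≡ v) ⊎ (x ≡ v × y ≡ u)

    Pair-∉ : ∀ {x y} → Pair x y → y ∉ H
    Pair-∉ (inj₁ (_ , refl)) = v∉H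
    Pair-∉ (inj₂ (_ , refl)) = u∉H

    Pair-marked : ∀ {x y} → Pair x y → Marked y
    Pair-marked (inj₁ (_ , refl)) = inj₂ (inj₂ refl)
    Pair-marked (inj₂ (_ , refl)) = inj₂ (inj₁ refl)

    Pair-below : ∀ {x y z} → Pair x y → Marked z → z Fin.< x → z ∈ H ⊎ z ≡ y
    Pair-below _                  (inj₁ z∈H)        _   = inj₁ z∈H
    Pair-below (inj₁ (refl , _)) (inj₂ (inj₁ refl)) z<x = contradiction z<x (<-irrefl refl)
    Pair-below (inj₁ (_ , refl)) (inj₂ (inj₂ refl)) _   = inj₂ refl
    Pair-below (inj₂ (_ , refl)) (inj₂ (inj₁ refl)) _   = inj₂ refl
    Pair-below (inj₂ (refl , _)) (inj₂ (inj₂ refl)) z<x = contradiction z<x (<-irrefl refl)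

    rank-pair : ∀ {x y} → Pair x y → rank x ≡ gap H x + count ((Finₚ._≟ y) ∩? (Fin._<? x))
    rank-pair {x} {y} xy = trans
      (count-cong (before? x) (holesBefore? H x ∪? ((Finₚ._≟ y) ∩? (Fin._<? x))) split join)
      (count-∪ (holesBefore? H x) ((Finₚ._≟ y) ∩? (Fin._<? x))
               λ (z∈H , _) (z≡y , _) → ∈⇒≢∉ z∈H (Pair-∉ xy) z≡y)
      where
      split : ∀ {z} → Marked z × z Fin.< x → (z ∈ H × z Fin.< x) ⊎ (z ≡ y × z Fin.< x)
      split (mz , z<x) = Sum.map (_, z<x) (_, z<x) (Pair-below xy mz z<x)
      join : ∀ {z} → (z ∈ H × z Fin.< x) ⊎ (z ≡ y × z Fin.< x) → Marked z × z Fin.< x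
      join (inj₁ (z∈H , z<x)) = inj₁ z∈H , z<x
      join (inj₂ (refl , z<x)) = Pair-marked xy , z<x

    rank-smaller : ∀ {x y} → Pair x y → x Fin.< y → rank x ≡ gap H x
    rank-smaller {x} xy x<y = trans (rank-pair xy)
      (trans (cong (gap H x +_) (count-≡∩≮ (<-asym x<y))) (+-identityʳ _))

    rank-larger : ∀ {x y} → Pair x y → y Fin.< x → rank x ≡ suc (gap H x)
    rank-larger {x} xy y<x = trans (rank-pair xy) (trans (cong (gap H x +_) (count-≡∩< y<x)) (+-comm _ 1))

    letter : Fin n → ℕ
    letter x = pAt p (rank x)

    letter-v<u : letter v < letter u
    letter-v<u = orient (proj₂ (proj₂ u→v))
      where
      orient : (u Fin.< v × pAt p (suc (gap H v)) < pAt p (gap H u)) ⊎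
               (v Fin.< u × pAt p (gap H v) < pAt p (suc (gap H u))) → letter v < letter u
      orient (inj₁ (u<v , lt)) = subst₂ _<_
        (cong (pAt p) (sym (rank-larger (inj₂ (refl , refl)) u<v)))
        (cong (pAt p) (sym (rank-smaller (inj₁ (refl , refl)) u<v))) lt
      orient (inj₂ (v<u , lt)) = subst₂ _<_
        (cong (pAt p) (sym (rank-smaller (inj₂ (refl , refl)) v<u)))
        (cong (pAt p) (sym (rank-larger (inj₁ (refl , refl)) v<u))) lt

    letter-injective : ∀ {x y} → Marked x → Marked y → letter x ≡ letter y → x ≡ y
    letter-injective mx my = rank-injective mx my ∘ pAt-injective p (rank<ℓ mx) (rank<ℓ my)

    -- A hole goes to the level of v if its letter is below that of u and to the level of u otherwise;
    -- letters break ties within a level. So the key increases with the letter on the marked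
    -- positions and with the value on the non-holes.
    level : ℕ → ℕ
    level q with q <? letter u
    ... | yes _ = W v
    ... | no _  = W u

    level-< : ∀ {q} → q < letter u → level q ≡ W v
    level-< {q} q<lu with q <? letter u
    ... | yes _   = refl
    ... | no q≮lu = contradiction q<lu q≮lu

    level-≮ : ∀ {q} → ¬ q < letter u → level q ≡ W u
    level-≮ {q} q≮lu with q <? letter u
    ... | yes q<lu = contradiction q<lu q≮lu
    ... | no _     = refl

    level-mono : ∀ {q q′} → q ≤ q′ → level q ≤ level q′
    level-mono {q} {q′} q≤q′ with q <? letter u | q′ <? letter u
    ... | yes _   | yes _    = ≤-refl
    ... | yes _   | no _     = <⇒≤ Wv<Wu
    ... | no q≮lu | yes q′<lu = contradiction (≤-<-trans q≤q′ q′<lu) q≮lu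
    ... | no _    | no _     = ≤-refl

    anchor : Fin n → ℕ
    anchor x with x ∈? H
    ... | yes _ = level (letter x)
    ... | no _  = W x

    anchor-∉ : ∀ {x} → x ∉ H → anchor x ≡ W x
    anchor-∉ {x} x∉H with x ∈? H
    ... | yes x∈H = contradiction x∈H x∉H
    ... | no _    = refl

    anchor-marked : ∀ {x} → Marked x → anchor x ≡ level (letter x)
    anchor-marked {x} (inj₁ x∈H) with x ∈? H
    ... | yes _   = refl
    ... | no x∉H  = contradiction x∈H x∉H
    anchor-marked (inj₂ (inj₁ refl)) = trans (anchor-∉ u∉H) (sym (level-≮ (<-irrefl refl)))
    anchor-marked (inj₂ (inj₂ refl)) = trans (anchor-∉ v∉H) (sym (level-< letter-v<u))

    key : Fin n → ℕ
    key x = anchor x * suc (suc k) + letter x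

    key-mono-letter : ∀ {x y} → Marked x → Marked y → letter x < letter y → key x < key y
    key-mono-letter {x} {y} mx my lx<ly = +-mono-≤-< (*-monoˡ-≤ (suc (suc k)) anchor≤) lx<ly
      where
      anchor≤ : anchor x ≤ anchor y
      anchor≤ = subst₂ _≤_ (sym (anchor-marked mx)) (sym (anchor-marked my)) (level-mono (<⇒≤ lx<ly))

    key-mono-W : ∀ {x y} → x ∉ H → y ∉ H → W x < W y → key x < key y
    key-mono-W {x} {y} x∉H y∉H Wx<Wy =
      subst₂ (λ a b → a * suc (suc k) + letter x < b * suc (suc k) + letter y)
             (sym (anchor-∉ x∉H)) (sym (anchor-∉ y∉H)) (lex-< Wx<Wy (pAt-< p (rank x)))

    σ : Permutation′ n
    σ = proj₁ (sortingPermutation key)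

    σ⟨_⟩ : Fin n → ℕ
    σ⟨ x ⟩ = toℕ (σ ⟨$⟩ʳ x)

    σ-mono : ∀ {x y} → key x < key y → σ⟨ x ⟩ < σ⟨ y ⟩
    σ-mono {x} {y} = proj₂ (sortingPermutation key) {x} {y}

    σ-mono-W : ∀ {x y} → x ∉ H → y ∉ H → W x < W y → σ⟨ x ⟩ < σ⟨ y ⟩
    σ-mono-W {x} {y} x∉H y∉H = σ-mono {x} {y} ∘ key-mono-W x∉H y∉H

    σ-mono-letter : ∀ {x y} → Marked x → Marked y → letter x < letter y → σ⟨ x ⟩ < σ⟨ y ⟩
    σ-mono-letter {x} {y} mx my = σ-mono {x} {y} ∘ key-mono-letter mx my

    σ-ext : IsExtension H σ π
    σ-ext i i∉H = begin
      lookup π i                                          ≡⟨ lookup-∉ i∉H ⟩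
      just (W i)                                          ≡⟨ cong just (count-value-< (proj₂ (value-range i∉H))) ⟨
      just (count (∁? (_∈? H) ∩? λ j → W j <? suc (W i))) ≡⟨ cong just (count-cong (∁? (_∈? H) ∩? λ j → W j <? suc (W i))
                                                                                  (∁? (_∈? H) ∩? λ j → σ⟨ j ⟩ ≤? σ⟨ i ⟩)
                                                                                  W⇒σ σ⇒W) ⟩
      just (stdRestr σ H i)                               ∎
      where
      open ≡-Reasoning
      open StrictMono W σ⟨_⟩ value-injective σ-mono-W
      W⇒σ : ∀ {j} → j ∉ H × W j < suc (W i) → j ∉ H × σ⟨ j ⟩ ≤ σ⟨ i ⟩
      W⇒σ (j∉H , Wj≤Wi) = j∉H , f≤⇒g≤ j∉H i∉H (≤-pred Wj≤Wi)
      σ⇒W : ∀ {j} → j ∉ H × σ⟨ j ⟩ ≤ σ⟨ i ⟩ → j ∉ H × W j < suc (W i)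
      σ⇒W (j∉H , σj≤σi) = j∉H , s≤s (≮⇒≥ λ Wi<Wj → <⇒≱ (σ-mono-W i∉H j∉H Wi<Wj) σj≤σi)

    enumeration : ∀ (a : Fin (suc (suc k))) → ∃ λ x → Marked x × rank x ≡ toℕ a
    enumeration a = rank-onto (subst (toℕ a <_) (sym count-marked) (Finₚ.toℕ<n a))

    enumerate : Fin (suc (suc k)) → Fin n
    enumerate = proj₁ ∘ enumeration

    enumerate-marked : ∀ a → Marked (enumerate a)
    enumerate-marked = proj₁ ∘ proj₂ ∘ enumeration

    rank-enumerate : ∀ a → rank (enumerate a) ≡ toℕ a
    rank-enumerate = proj₂ ∘ proj₂ ∘ enumeration

    letter-enumerate : ∀ a → letter (enumerate a) ≡ toℕ (p ⟨$⟩ʳ a)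
    letter-enumerate a = trans (cong (pAt p) (rank-enumerate a)) (pAt-toℕ p a)

    σ-contains-p : Contains σ p
    σ-contains-p = enumerate , enumerate-mono , λ a b → p<⇒σ< a b , σ<⇒p< a b
      where
      open StrictMono toℕ rank (λ _ _ → Finₚ.toℕ-injective) (λ mx _ → rank-mono mx)
        renaming (g<⇒f< to rank<⇒<)
      open StrictMono letter σ⟨_⟩ letter-injective σ-mono-letter
        renaming (g<⇒f< to σ<⇒letter<)
      enumerate-mono : ∀ a b → a Fin.< b → enumerate a Fin.< enumerate b
      enumerate-mono a b a<b = rank<⇒< (enumerate-marked a) (enumerate-marked b)
        (subst₂ _<_ (sym (rank-enumerate a)) (sym (rank-enumerate b)) a<b)
      p<⇒σ< : ∀ a b → p ⟨$⟩ʳ a Fin.< p ⟨$⟩ʳ b → σ⟨ enumerate a ⟩ < σ⟨ enumerate b ⟩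
      p<⇒σ< a b pa<pb = σ-mono-letter (enumerate-marked a) (enumerate-marked b)
        (subst₂ _<_ (sym (letter-enumerate a)) (sym (letter-enumerate b)) pa<pb)
      σ<⇒p< : ∀ a b → σ⟨ enumerate a ⟩ < σ⟨ enumerate b ⟩ → p ⟨$⟩ʳ a Fin.< p ⟨$⟩ʳ b
      σ<⇒p< a b σa<σb = subst₂ _<_ (letter-enumerate a) (letter-enumerate b)
        (σ<⇒letter< (enumerate-marked a) (enumerate-marked b) σa<σb)

  avoids⇒respects : ∀ {π} → IsPartialPerm k H π → AvoidsPartial H π p → Respects (value π)
  avoids⇒respects {π} π-pp avoids {x} {y} x→y with <-cmp (value π x) (value π y)
  ... | tri< Wx<Wy _ _ = Wx<Wy
  ... | tri≈ _ Wx≡Wy _ = contradiction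
    (PartialPerm.value-injective {k = k} {π = π} π-pp (proj₁ x→y) (proj₁ (proj₂ x→y)) Wx≡Wy) (Edge⇒≢ x→y)
  ... | tri> _ _ Wy<Wx = contradiction σ-contains-p (avoids σ σ-ext)
    where open Inversion {π = π} π-pp x→y Wy<Wx

  module Canonical (no3 : ¬ HasDirectedCycleOfLength 3 p H) where

    open Rank (∁? (_∈? H)) Edge? (Edge-trans no3) Edge-irrefl Edge-connex

    π₀ : Vec (Maybe ℕ) n
    π₀ = tabulate (fill H (suc ∘ rank))

    π₀-pp : IsPartialPerm k H π₀
    π₀-pp = tabulate-fill-isPartialPerm {k = k} H (suc ∘ rank) range
      (λ {x} {y} x∉H y∉H → rank-injective {x} {y} x∉H y∉H ∘ suc-injective) onto
      where
      count-∉H : count (∁? (_∈? H)) ≡ n ∸ k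
      count-∉H = trans (count-∉ H) (cong (n ∸_) ∣H∣≡k)
      range : ∀ {x} → x ∉ H → 1 ≤ suc (rank x) × suc (rank x) ≤ n ∸ k
      range {x} x∉H = s≤s z≤n , subst (rank x <_) count-∉H (rank-< x∉H)
      onto : ∀ {v} → 1 ≤ v → v ≤ n ∸ k → ∃ λ x → x ∉ H × suc (rank x) ≡ v
      onto {suc v} _ 1+v≤N =
        let x , x∉H , rank≡v = rank-onto (subst (v <_) (sym count-∉H) 1+v≤N) in x , x∉H , cong suc rank≡v

    π₀-respects : Respects (value π₀)
    π₀-respects {x} {y} x→y@(x∉H , y∉H , _) =
      subst₂ _<_ (sym (value-π₀ x∉H)) (sym (value-π₀ y∉H)) (s≤s (rank-mono x∉H x→y))
      where
      value-π₀ : ∀ {z} → z ∉ H → value π₀ z ≡ suc (rank z)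
      value-π₀ {z} z∉H = cong (fromMaybe 0) (trans (lookup∘tabulate _ z) (fill-∉ z∉H))

  unique⇒acyclic : SEqualsOne k H p → ¬ HasDirectedCycle p H
  unique⇒acyclic (π , (π-pp , π-avoids) , _) = respects⇒acyclic (avoids⇒respects {π} π-pp π-avoids)

  acyclic⇒unique : ¬ HasDirectedCycle p H → SEqualsOne k H p
  acyclic⇒unique acyclic = π₀ , (π₀-pp , respects⇒avoids π₀ π₀-respects) , λ π π-pp π-avoids →
    sym (≡-fromOrder {k = k} π₀-pp π-pp (respects-order π₀-respects (avoids⇒respects {π} π-pp π-avoids)))
    where open Canonical (Equivalence.to acyclic⇔no-3-cycle acyclic)

lemma24 : (ℓ : ℕ) → 2 ≤ ℓ → (p : Permutation′ ℓ) → (n : ℕ) → (H : Subset n) →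
          ∣ H ∣ ≡ ℓ ∸ 2 →
          ((SEqualsOne (ℓ ∸ 2) H p ⇔ (¬ HasDirectedCycle p H)) ×
           ((¬ HasDirectedCycle p H) ⇔ (¬ HasDirectedCycleOfLength 3 p H)))
lemma24 (suc (suc k)) (s≤s (s≤s z≤n)) p n H ∣H∣≡k = mk⇔ unique⇒acyclic acyclic⇒unique , acyclic⇔no-3-cycle
  where open OrderGraph p H ∣H∣≡k
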